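{- Let $w\in\{0,1\}^n$ and $r$ a positive integer. Let $RankSL(w,2r)$ be the number of symmetric Lyndon words of length $2r$ whose canonical representation is smaller than $w$, and let $\mathbf{RB}(w,2r,S,r)$ be the set of words $v$ of length $2r$ such that the necklace containing $v$ is a symmetric Lyndon word with canonical representation smaller than $w$ and $r$ is the smallest positive integer for which $v_i = S(v_{i+r \bmod 2r})$ for every $i\in\{1,\dots,2r\}$. Then $RankSL(w,2r) = \frac{|\mathbf{RB}(w,2r,S,r)|}{2r}$.
   Context: Alphabet $\{0,1\}$, $0<1$; words of equal length compared lexicographically, and for different lengths $v<u$ iff $v^{|u|}<u^{|v|}$ lexicographically or these are equal and $|v|<|u|$. A necklace is an equivalence class of words under rotation, with canonical representation its lexicographically smallest element; a Lyndon word is a necklace of an aperiodic word (a word not of the form $u^t$ with $t\ge2$). $S$ swaps $0$ and $1$ symbolwise; a necklace $N$ is symmetric if $S(N)=N$. Indices are taken modulo $2r$ within $\{1,\dots,2r\}$. -}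

module Defs where

open import Data.Bool using (Bool; true; false; not)
import Data.Bool as B
open import Data.Nat using (ℕ; zero; suc; _*_; _<_)
open import Data.List using (List; []; _∷_; _++_; [_]; length; map; concat; replicate)
open import Data.List.Relation.Binary.Lex.Core using (Lex-<; Lex-≤)
open import Data.List.Membership.Propositional using (_∈_)
open import Data.List.Relation.Unary.Unique.Propositional using (Unique)
open import Data.Product using (Σ; _×_; ∃)
open import Data.Sum using (_⊎_)
open import Function.Bundles using (_⇔_)
open import Relation.Nullary using (¬_)
open import Relation.Binary.PropositionalEquality using (_≡_)

-- Words over {0,1}: 0 = false, 1 = true, so 0 < 1 is B._<_ (false < true).
Word : Set
Word = List Bool

_<lex_ : Word → Word → Set
_<lex_ = Lex-< _≡_ B._<_

_≤lex_ : Word → Word → Set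
_≤lex_ = Lex-≤ _≡_ B._<_

pow : Word → ℕ → Word
pow v k = concat (replicate k v)

_≺_ : Word → Word → Set
v ≺ u = (pow v (length u) <lex pow u (length v))
      ⊎ (pow v (length u) ≡ pow u (length v) × length v < length u)

-- Cyclic rotation by one position to the left, and by t positions.
-- (rotate t v) at index i (0-based) is v at index (i + t) mod |v|.
rot1 : Word → Word
rot1 []       = []
rot1 (x ∷ xs) = xs ++ [ x ]

rotate : ℕ → Word → Word
rotate zero    v = v
rotate (suc t) v = rotate t (rot1 v)

S : Word → Word
S = map not

SameNecklace : Word → Word → Set
SameNecklace u v = ∃ λ k → rotate k u ≡ v

IsCanonical : Word → Set
IsCanonical x = ∀ k → x ≤lex rotate k x

Aperiodic : Word → Set
Aperiodic x = ¬ (Σ Word λ u → Σ ℕ λ t → 2 Data.Nat.≤ t × x ≡ pow u t)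

-- x is the canonical representation of a symmetric Lyndon word (necklace):
-- canonical, aperiodic, and S(N) = N, i.e. S x lies in the necklace of x.
IsSymLyndonRep : Word → Set
IsSymLyndonRep x = IsCanonical x × Aperiodic x × SameNecklace x (S x)

-- Canonical representations of symmetric Lyndon words of length m smaller than w
-- (the set counted by RankSL(w, m)).
SymLyndonBelow : Word → ℕ → Word → Set
SymLyndonBelow w m x = length x ≡ m × IsSymLyndonRep x × x ≺ w

AntiPeriod : Word → ℕ → Set
AntiPeriod v t = v ≡ S (rotate t v)

IsMinAntiPeriod : Word → ℕ → Set
IsMinAntiPeriod v r =
  0 < r × AntiPeriod v r × (∀ t → 0 < t → t < r → ¬ AntiPeriod v t)

RB : Word → ℕ → Word → Set
RB w r v = length v ≡ 2 * r
         × (Σ Word λ x → SameNecklace v x × SymLyndonBelow w (2 * r) x)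
         × IsMinAntiPeriod v r

HasCard : (Word → Set) → ℕ → Set
HasCard P c = Σ (List Word) λ L → Unique L × (∀ x → (x ∈ L) ⇔ P x) × length L ≡ c

-- A word fixed by a proper rotation is a proper power (by Bézout, the gcd of the shift and the
-- length is again a period), so an aperiodic word x has |x| pairwise distinct rotations, and
-- rotⁱ x = x forces |x| ∣ i. If x is a symmetric Lyndon word of length 2r, say rotʲ x = S x
-- with j < 2r, then rot²ʲ x = x, so 2r ∣ 2j; as x ≠ S x this leaves j = r. Consequently every
-- rotation of x has minimal antiperiod r, and RB(w,2r,S,r) is the union of the rotation
-- classes of the RankSL(w,2r) canonical representatives; these classes are disjoint (two
-- canonical words in one necklace coincide) and have 2r elements each.

module Submission where

open import Defs
open import Data.Bool using (Bool; true; false; not)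
import Data.Bool.Properties as BP
open import Data.Nat
  using (ℕ; zero; suc; _+_; _*_; _∸_; _<_; _≤_; _<?_; _≟_; z≤n; s≤s; NonZero; >-nonZero)
open import Data.Nat.Properties
open import Data.Nat.DivMod using (_%_; _/_; m≡m%n+[m/n]*n; m%n<n)
open import Data.Nat.Divisibility using (_∣_; divides; ∣⇒≤; quotient>1; m%n≡0⇒n∣m)
open import Data.Nat.GCD using (gcd; gcd-GCD; gcd[m,n]∣m; gcd[m,n]∣n; module Bézout)
open import Data.List
  using (List; []; _∷_; _++_; [_]; length; map; take; drop; applyUpTo; concatMap; filter)
open import Data.List.Properties
  using ( ∷-injective; ∷-injectiveˡ; ∷-injectiveʳ; ++-assoc; ++-identityʳ; map-++; ≡-dec
        ; length-++; length-take; length-drop; take++drop≡id; length-applyUpTo)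
import Data.List.Relation.Binary.Lex.Strict as Lex
open import Data.List.Relation.Binary.Pointwise using (Pointwise-≡⇒≡)
open import Data.List.Membership.Propositional using (_∈_)
open import Data.List.Membership.Propositional.Properties
  using (∈-map⁺; ∈-map⁻; ∈-++⁺ˡ; ∈-++⁺ʳ; ∈-++⁻; ∈-filter⁺; ∈-filter⁻; ∈-applyUpTo⁺; ∈-applyUpTo⁻)
open import Data.List.Relation.Unary.Any using (here; there)
import Data.List.Relation.Unary.All as All
open import Data.List.Relation.Unary.AllPairs using ([]; _∷_)
open import Data.List.Relation.Unary.Unique.Propositional using (Unique)
import Data.List.Relation.Unary.Unique.Propositional.Properties as UP
open import Function using (_∘_)
open import Function.Bundles using (_⇔_; mk⇔; Equivalence)
open import Data.Product using (Σ; _×_; _,_; ∃; proj₁; proj₂; map₁)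
open import Data.Sum using (_⊎_; inj₁; inj₂)
open import Data.Empty using (⊥; ⊥-elim)
open import Relation.Nullary using (¬_; Dec; ¬?)
open import Relation.Nullary.Decidable using (map′; _×-dec_; _⊎-dec_; _→-dec_)
open import Relation.Unary using (Decidable)
open import Relation.Binary.Definitions using (DecidableEquality)
open import Relation.Binary.PropositionalEquality hiding ([_])

rot1-map : ∀ (f : Bool → Bool) x → rot1 (map f x) ≡ map f (rot1 x)
rot1-map f []       = refl
rot1-map f (a ∷ xs) = sym (map-++ f xs [ a ])

rotate-map : ∀ (f : Bool → Bool) k x → rotate k (map f x) ≡ map f (rotate k x)
rotate-map f zero    x = refl
rotate-map f (suc k) x = trans (cong (rotate k) (rot1-map f x)) (rotate-map f k (rot1 x))

rotate-rot1 : ∀ k x → rotate k (rot1 x) ≡ rot1 (rotate k x)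
rotate-rot1 zero    x = refl
rotate-rot1 (suc k) x = rotate-rot1 k (rot1 x)

rotate-+ : ∀ a b x → rotate (a + b) x ≡ rotate a (rotate b x)
rotate-+ zero    b x = refl
rotate-+ (suc a) b x = trans (rotate-+ a b (rot1 x)) (cong (rotate a) (rotate-rot1 b x))

rotate-comm : ∀ a b x → rotate a (rotate b x) ≡ rotate b (rotate a x)
rotate-comm a b x = begin
  rotate a (rotate b x) ≡⟨ rotate-+ a b x ⟨
  rotate (a + b) x      ≡⟨ cong (λ k → rotate k x) (+-comm a b) ⟩
  rotate (b + a) x      ≡⟨ rotate-+ b a x ⟩
  rotate b (rotate a x) ∎
  where open ≡-Reasoning

rotate-[] : ∀ k → rotate k [] ≡ []
rotate-[] zero    = refl
rotate-[] (suc k) = rotate-[] k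

length-rot1 : ∀ x → length (rot1 x) ≡ length x
length-rot1 []       = refl
length-rot1 (a ∷ xs) = trans (length-++ xs) (+-comm (length xs) 1)

length-rotate : ∀ k x → length (rotate k x) ≡ length x
length-rotate zero    x = refl
length-rotate (suc k) x = trans (length-rotate k (rot1 x)) (length-rot1 x)

rotate-++ : ∀ (u z : Word) → rotate (length u) (u ++ z) ≡ z ++ u
rotate-++ []      z = sym (++-identityʳ z)
rotate-++ (a ∷ u) z = begin
  rotate (length u) ((u ++ z) ++ [ a ]) ≡⟨ cong (rotate (length u)) (++-assoc u z [ a ]) ⟩
  rotate (length u) (u ++ z ++ [ a ])   ≡⟨ rotate-++ u (z ++ [ a ]) ⟩
  (z ++ [ a ]) ++ u                     ≡⟨ ++-assoc z [ a ] u ⟩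
  z ++ a ∷ u                            ∎
  where open ≡-Reasoning

rotate-length : ∀ x → rotate (length x) x ≡ x
rotate-length x = trans (cong (rotate (length x)) (sym (++-identityʳ x))) (rotate-++ x [])

rotate-fixed-* : ∀ {p x} → rotate p x ≡ x → ∀ q → rotate (q * p) x ≡ x
rotate-fixed-* fix zero    = refl
rotate-fixed-* {p} {x} fix (suc q) =
  trans (rotate-+ p (q * p) x) (trans (cong (rotate p) (rotate-fixed-* fix q)) fix)

rotate-fixed-+ : ∀ {m x} d → rotate m x ≡ x → rotate (d + m) x ≡ rotate d x
rotate-fixed-+ {m} {x} d fix = trans (rotate-+ d m x) (cong (rotate d) fix)

rotate-mod : ∀ k x .{{_ : NonZero (length x)}} → rotate k x ≡ rotate (k % length x) x
rotate-mod k x = begin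
  rotate k x                   ≡⟨ cong (λ j → rotate j x) (m≡m%n+[m/n]*n k n) ⟩
  rotate (k % n + k / n * n) x ≡⟨ rotate-fixed-+ (k % n) (rotate-fixed-* (rotate-length x) (k / n)) ⟩
  rotate (k % n) x             ∎
  where
  open ≡-Reasoning
  n : ℕ
  n = length x

rotate-reduce : ∀ k x → 0 < length x → ∃ λ i → i < length x × rotate i x ≡ rotate k x
rotate-reduce k x@(_ ∷ _) _ = k % length x , m%n<n k (length x) , sym (rotate-mod k x)

rotate-bounded : ∀ k x → ∃ λ i → i ≤ length x × rotate i x ≡ rotate k x
rotate-bounded k []          = 0 , z≤n , sym (rotate-[] k)
rotate-bounded k x@(_ ∷ _) with rotate-reduce k x (s≤s z≤n)
... | i , i<n , e = i , <⇒≤ i<n , e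

rotate-inverse : ∀ k x → rotate ((length x ∸ 1) * k) (rotate k x) ≡ x
rotate-inverse k []          = trans (cong (rotate ((0 ∸ 1) * k)) (rotate-[] k)) (rotate-[] ((0 ∸ 1) * k))
rotate-inverse k x@(_ ∷ xs) = begin
  rotate (length xs * k) (rotate k x) ≡⟨ rotate-+ (length xs * k) k x ⟨
  rotate (length xs * k + k) x        ≡⟨ cong (λ j → rotate j x) (+-comm (length xs * k) k) ⟩
  rotate (length x * k) x             ≡⟨ cong (λ j → rotate j x) (*-comm (length x) k) ⟩
  rotate (k * length x) x             ≡⟨ rotate-fixed-* (rotate-length x) k ⟩
  x                                   ∎
  where open ≡-Reasoning

rotate-injective : ∀ k {x y} → rotate k x ≡ rotate k y → x ≡ y
rotate-injective k {x} {y} e = begin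
  x                                        ≡⟨ rotate-inverse k x ⟨
  rotate ((length x ∸ 1) * k) (rotate k x) ≡⟨ cong₂ (λ l z → rotate ((l ∸ 1) * k) z) lengths e ⟩
  rotate ((length y ∸ 1) * k) (rotate k y) ≡⟨ rotate-inverse k y ⟩
  y                                        ∎
  where
  open ≡-Reasoning
  lengths : length x ≡ length y
  lengths = trans (sym (length-rotate k x)) (trans (cong length e) (length-rotate k y))

S-involutive : ∀ x → S (S x) ≡ x
S-involutive []       = refl
S-involutive (a ∷ xs) = cong₂ _∷_ (BP.not-involutive a) (S-involutive xs)

S-injective : ∀ {x y} → S x ≡ S y → x ≡ y
S-injective {x} {y} e = trans (sym (S-involutive x)) (trans (cong S e) (S-involutive y))

S-fixed-free : ∀ {x} → 0 < length x → x ≢ S x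
S-fixed-free {_ ∷ _} _ e = BP.not-¬ refl (∷-injectiveˡ e)

rotate-S : ∀ k x → rotate k (S x) ≡ S (rotate k x)
rotate-S = rotate-map not

length-pow : ∀ (u : Word) t → length (pow u t) ≡ t * length u
length-pow u zero    = refl
length-pow u (suc t) = trans (length-++ u) (cong (length u +_) (length-pow u t))

rotate-pow : ∀ (u : Word) t → rotate (length u) (pow u (suc t)) ≡ pow u (suc t)
rotate-pow u t = trans (rotate-++ u (pow u t)) (pow-snoc t)
  where
  pow-snoc : ∀ t → pow u t ++ u ≡ u ++ pow u t
  pow-snoc zero    = sym (++-identityʳ u)
  pow-snoc (suc t) = trans (++-assoc u (pow u t) u) (cong (u ++_) (pow-snoc t))

++-injective : ∀ {A : Set} (a c : List A) {b d} →
               length a ≡ length c → a ++ b ≡ c ++ d → a ≡ c × b ≡ d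
++-injective []      []      _ e = refl , e
++-injective (x ∷ a) (y ∷ c) l e with ∷-injective e
... | refl , e′ = map₁ (cong (x ∷_)) (++-injective a c (suc-injective l) e′)

length-take-≤ : ∀ {A : Set} {n} (xs : List A) → n ≤ length xs → length (take n xs) ≡ n
length-take-≤ {n = n} xs n≤ = trans (length-take n xs) (m≤n⇒m⊓n≡m n≤)

commuting⇒power : ∀ m (u y : Word) → length y ≡ m * length u → y ++ u ≡ u ++ y → y ≡ pow u m
commuting⇒power zero    u [] _ _ = refl
commuting⇒power (suc m) u y l e with ++-injective (take (length u) y) u len-head split
  where
  len-head : length (take (length u) y) ≡ length u
  len-head = length-take-≤ y (subst (length u ≤_) (sym l) (m≤m+n (length u) (m * length u)))
  split : take (length u) y ++ drop (length u) y ++ u ≡ u ++ y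
  split = trans (sym (++-assoc (take (length u) y) _ u))
                (trans (cong (_++ u) (take++drop≡id (length u) y)) e)
... | head≡u , tail++u≡y =
  trans y≡u++tail (cong (u ++_) (commuting⇒power m u tail len-tail tail-commutes))
  where
  tail : Word
  tail = drop (length u) y
  y≡u++tail : y ≡ u ++ tail
  y≡u++tail = trans (sym (take++drop≡id (length u) y)) (cong (_++ tail) head≡u)
  len-tail : length tail ≡ m * length u
  len-tail = trans (length-drop (length u) y)
                   (trans (cong (_∸ length u) l) (m+n∸m≡n (length u) (m * length u)))
  tail-commutes : tail ++ u ≡ u ++ tail
  tail-commutes = trans tail++u≡y y≡u++tail

rotate-fixed⇒power : ∀ d q x → length x ≡ suc q * d → rotate d x ≡ x →
                     x ≡ pow (take d x) (suc q)
rotate-fixed⇒power d q x l fix =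
  trans (sym (take++drop≡id d x)) (cong (u ++_) (commuting⇒power q u y len-y commutes))
  where
  u y : Word
  u = take d x
  y = drop d x
  d≤ : d ≤ length x
  d≤ = subst (d ≤_) (sym l) (m≤m+n d (q * d))
  len-u : length u ≡ d
  len-u = length-take-≤ x d≤
  len-y : length y ≡ q * length u
  len-y = trans (length-drop d x)
                (trans (cong (_∸ d) l) (trans (m+n∸m≡n d (q * d)) (cong (q *_) (sym len-u))))
  commutes : y ++ u ≡ u ++ y
  commutes = begin
    y ++ u                         ≡⟨ rotate-++ u y ⟨
    rotate (length u) (u ++ y)     ≡⟨ cong₂ rotate len-u (take++drop≡id d x) ⟩
    rotate d x                     ≡⟨ fix ⟩
    x                              ≡⟨ take++drop≡id d x ⟨
    u ++ y                         ∎
    where open ≡-Reasoning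

rotate-fixed-gcd : ∀ p x → rotate p x ≡ x → rotate (gcd p (length x)) x ≡ x
rotate-fixed-gcd p x fix = period (Bézout.identity (gcd-GCD p (length x)))
  where
  open ≡-Reasoning
  period : ∀ {d} → Bézout.Identity d p (length x) → rotate d x ≡ x
  period {d} (Bézout.+- a b eq) = begin
    rotate d x                  ≡⟨ rotate-fixed-+ d (rotate-fixed-* (rotate-length x) b) ⟨
    rotate (d + b * length x) x ≡⟨ cong (λ k → rotate k x) eq ⟩
    rotate (a * p) x            ≡⟨ rotate-fixed-* fix a ⟩
    x                           ∎
  period {d} (Bézout.-+ a b eq) = begin
    rotate d x                  ≡⟨ rotate-fixed-+ d (rotate-fixed-* fix a) ⟨
    rotate (d + a * p) x        ≡⟨ cong (λ k → rotate k x) eq ⟩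
    rotate (b * length x) x     ≡⟨ rotate-fixed-* (rotate-length x) b ⟩
    x                           ∎

aperiodic⇒nonempty : ∀ {x} → Aperiodic x → 0 < length x
aperiodic⇒nonempty {[]}    ap = ⊥-elim (ap ([] , 2 , s≤s (s≤s z≤n) , refl))
aperiodic⇒nonempty {_ ∷ _} ap = s≤s z≤n

aperiodic⇒rotate≢ : ∀ {x p} → Aperiodic x → 0 < p → p < length x → rotate p x ≢ x
aperiodic⇒rotate≢ {x} {p} ap 0<p p<n fix =
  periodic (quotient d∣n) (quotient>1 d∣n d<n) (equality d∣n)
  where
  open _∣_
  d : ℕ
  d = gcd p (length x)
  d∣n : d ∣ length x
  d∣n = gcd[m,n]∣n p (length x)
  d<n : d < length x
  d<n = ≤-<-trans (∣⇒≤ {{>-nonZero 0<p}} (gcd[m,n]∣m p (length x))) p<n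
  periodic : ∀ q → 1 < q → length x ≡ q * d → ⊥
  periodic (suc q) 1<q eq =
    ap (take d x , suc q , 1<q , rotate-fixed⇒power d q x eq (rotate-fixed-gcd p x fix))

rotate≢⇒aperiodic : ∀ {x} → 0 < length x → (∀ {k} → k < length x → 0 < k → rotate k x ≢ x) →
                    Aperiodic x
rotate≢⇒aperiodic {x} 0<n moves ([] , t , _ , x≡)
  = <-irrefl (sym (trans (cong length x≡) (trans (length-pow [] t) (*-zeroʳ t)))) 0<n
rotate≢⇒aperiodic _ _ (_ ∷ _ , 1 , s≤s () , _)
rotate≢⇒aperiodic {x} 0<n moves (u@(_ ∷ _) , suc (suc t) , _ , x≡) = moves |u|<n (s≤s z≤n) fix
  where
  fix : rotate (length u) x ≡ x
  fix = subst (λ y → rotate (length u) y ≡ y) (sym x≡) (rotate-pow u (suc t))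
  |u|<n : length u < length x
  |u|<n = subst (length u <_) (sym (trans (cong length x≡) (length-pow u (suc (suc t)))))
                (m<m+n (length u) (≤-trans (s≤s z≤n) (m≤m+n (length u) (t * length u))))

aperiodic-rotate-fixed⇒∣ : ∀ {x k} → Aperiodic x → rotate k x ≡ x → length x ∣ k
aperiodic-rotate-fixed⇒∣ {x} {k} ap fix =
  m%n≡0⇒n∣m k (length x)
    (residue-zero (k % length x) (m%n<n k (length x)) (trans (sym (rotate-mod k x)) fix))
  where
  instance
    n≢0 : NonZero (length x)
    n≢0 = >-nonZero (aperiodic⇒nonempty ap)
  residue-zero : ∀ i → i < length x → rotate i x ≡ x → i ≡ 0
  residue-zero zero    _   _    = refl
  residue-zero (suc i) i<n fix′ = ⊥-elim (aperiodic⇒rotate≢ ap (s≤s z≤n) i<n fix′)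

sameNecklace-sym : ∀ {u v} → SameNecklace u v → SameNecklace v u
sameNecklace-sym {u} (k , refl) = (length u ∸ 1) * k , rotate-inverse k u

sameNecklace-trans : ∀ {u v w} → SameNecklace u v → SameNecklace v w → SameNecklace u w
sameNecklace-trans {u} (a , refl) (b , refl) = b + a , rotate-+ b a u

≤lex-antisym : ∀ {x y} → x ≤lex y → y ≤lex x → x ≡ y
≤lex-antisym x≤y y≤x = Pointwise-≡⇒≡ (Lex.≤-antisymmetric sym BP.<-irrefl BP.<-asym x≤y y≤x)

canonical-unique : ∀ {x y} → IsCanonical x → IsCanonical y → SameNecklace x y → x ≡ y
canonical-unique {x} {y} cx cy (k , e) with sameNecklace-sym (k , e)
... | k′ , e′ = ≤lex-antisym (subst (x ≤lex_) e (cx k)) (subst (y ≤lex_) e′ (cy k′))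

aperiodic-rotate⁻ : ∀ k {v} → Aperiodic (rotate k v) → Aperiodic v
aperiodic-rotate⁻ k {v} ap =
  rotate≢⇒aperiodic (subst (0 <_) (length-rotate k v) (aperiodic⇒nonempty ap)) moves
  where
  moves : ∀ {d} → d < length v → 0 < d → rotate d v ≢ v
  moves {d} d<n 0<d fix = aperiodic⇒rotate≢ ap 0<d (subst (d <_) (sym (length-rotate k v)) d<n)
    (trans (rotate-comm d k v) (cong (rotate k) fix))

symmetric-rotate⁻ : ∀ k {v} → SameNecklace (rotate k v) (S (rotate k v)) → SameNecklace v (S v)
symmetric-rotate⁻ k {v} (j , e) = j , rotate-injective k (begin
  rotate k (rotate j v) ≡⟨ rotate-comm k j v ⟩
  rotate j (rotate k v) ≡⟨ e ⟩
  S (rotate k v)        ≡⟨ rotate-S k v ⟨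
  rotate k (S v)        ∎)
  where open ≡-Reasoning

rotate-twice-S : ∀ j x → rotate j x ≡ S x → rotate (j + j) x ≡ x
rotate-twice-S j x e = begin
  rotate (j + j) x      ≡⟨ rotate-+ j j x ⟩
  rotate j (rotate j x) ≡⟨ cong (rotate j) e ⟩
  rotate j (S x)        ≡⟨ rotate-S j x ⟩
  S (rotate j x)        ≡⟨ cong S e ⟩
  S (S x)               ≡⟨ S-involutive x ⟩
  x                     ∎
  where open ≡-Reasoning

double-∣-double : ∀ {i r} → i < r + r → (r + r) ∣ (i + i) → i ≡ 0 ⊎ i ≡ r
double-∣-double {i} {r} _ (divides zero eq) = inj₁ (m+n≡0⇒m≡0 i eq)
double-∣-double {i} {r} _ (divides 1 eq) = inj₂ (*-cancelˡ-≡ i r 2 (begin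
  i + (i + 0) ≡⟨ cong (i +_) (+-identityʳ i) ⟩
  i + i       ≡⟨ eq ⟩
  r + r + 0   ≡⟨ +-identityʳ (r + r) ⟩
  r + r       ≡⟨ cong (r +_) (+-identityʳ r) ⟨
  r + (r + 0) ∎))
  where open ≡-Reasoning
double-∣-double {i} {r} i<2r (divides (suc (suc q)) eq) = ⊥-elim (<-irrefl eq (begin-strict
  i + i                 <⟨ +-mono-< i<2r i<2r ⟩
  (r + r) + (r + r)     ≤⟨ +-monoʳ-≤ (r + r) (m≤m+n (r + r) (q * (r + r))) ⟩
  suc (suc q) * (r + r) ∎))
  where open ≤-Reasoning

symmetric-aperiodic⇒rotate-half : ∀ {x r} → length x ≡ r + r → Aperiodic x → SameNecklace x (S x) →
                                  rotate r x ≡ S x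
symmetric-aperiodic⇒rotate-half {x} {r} len ap (j , e) with rotate-reduce j x (aperiodic⇒nonempty ap)
... | i , i<n , eᵢ = half i (double-∣-double {i} {r} (subst (i <_) len i<n) 2r∣2i) anti
  where
  anti : rotate i x ≡ S x
  anti = trans eᵢ e
  2r∣2i : (r + r) ∣ (i + i)
  2r∣2i = subst (_∣ i + i) len (aperiodic-rotate-fixed⇒∣ ap (rotate-twice-S i x anti))
  half : ∀ i → i ≡ 0 ⊎ i ≡ r → rotate i x ≡ S x → rotate r x ≡ S x
  half _ (inj₁ refl) anti′ = ⊥-elim (S-fixed-free (aperiodic⇒nonempty ap) anti′)
  half _ (inj₂ refl) anti′ = anti′

antiPeriod-minimal : ∀ {v r t} → Aperiodic v → length v ≡ r + r → rotate r v ≡ S v →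
                     0 < t → t < r → ¬ AntiPeriod v t
antiPeriod-minimal {v} {r} {t} ap len half 0<t t<r at =
  aperiodic⇒rotate≢ ap (m<n⇒0<n∸m t<r) r∸t<n (S-injective (begin
    S (rotate (r ∸ t) v)        ≡⟨ rotate-S (r ∸ t) v ⟨
    rotate (r ∸ t) (S v)        ≡⟨ cong (rotate (r ∸ t)) shift ⟨
    rotate (r ∸ t) (rotate t v) ≡⟨ rotate-+ (r ∸ t) t v ⟨
    rotate (r ∸ t + t) v        ≡⟨ cong (λ k → rotate k v) (m∸n+n≡m (<⇒≤ t<r)) ⟩
    rotate r v                  ≡⟨ half ⟩
    S v                         ∎))
  where
  open ≡-Reasoning
  shift : rotate t v ≡ S v
  shift = trans (sym (S-involutive (rotate t v))) (cong S (sym at))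
  r∸t<n : r ∸ t < length v
  r∸t<n = ≤-<-trans (m∸n≤m r t) (subst (r <_) (sym len) (m<m+n r (<-trans 0<t t<r)))

necklace-minAntiPeriod : ∀ {v x r} → 0 < r → length x ≡ r + r → Aperiodic x → SameNecklace x (S x) →
                         SameNecklace v x → IsMinAntiPeriod v r
necklace-minAntiPeriod {v} {x} {r} 0<r len ap symmetric (k , refl) = 0<r , antiPeriod , minimal
  where
  len-v : length v ≡ r + r
  len-v = trans (sym (length-rotate k v)) len
  ap-v : Aperiodic v
  ap-v = aperiodic-rotate⁻ k ap
  half : rotate r v ≡ S v
  half = symmetric-aperiodic⇒rotate-half {r = r} len-v ap-v (symmetric-rotate⁻ k symmetric)
  antiPeriod : AntiPeriod v r
  antiPeriod = trans (sym (S-involutive v)) (cong S (sym half))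
  minimal : ∀ t → 0 < t → t < r → ¬ AntiPeriod v t
  minimal t = antiPeriod-minimal ap-v len-v half

sameNecklace-symLyndonBelow⇒RB : ∀ {w r v x} → 0 < r → SameNecklace v x → SymLyndonBelow w (2 * r) x →
                                 RB w r v
sameNecklace-symLyndonBelow⇒RB {w} {r} {v} {x} 0<r (k , e) sx@(len , (_ , ap , symmetric) , _) =
  len-v , (x , (k , e) , sx) , necklace-minAntiPeriod 0<r (trans len 2r≡r+r) ap symmetric (k , e)
  where
  2r≡r+r : 2 * r ≡ r + r
  2r≡r+r = cong (r +_) (+-identityʳ r)
  len-v : length v ≡ 2 * r
  len-v = trans (sym (length-rotate k v)) (trans (cong length e) len)

module _ {P : Word → Set} (P? : Decidable P) (x : Word) where

  allRotations? : Dec (∀ k → P (rotate k x))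
  allRotations? = map′ every (λ h {i} _ → h i) (allUpTo? (λ i → P? (rotate i x)) (suc (length x)))
    where
    every : (∀ {i} → i < suc (length x) → P (rotate i x)) → ∀ k → P (rotate k x)
    every h k with rotate-bounded k x
    ... | i , i≤n , e = subst P e (h (s≤s i≤n))

  anyRotation? : Dec (∃ λ k → P (rotate k x))
  anyRotation? = map′ (λ (i , _ , p) → i , p) some (anyUpTo? (λ i → P? (rotate i x)) (suc (length x)))
    where
    some : (∃ λ k → P (rotate k x)) → ∃ λ i → i < suc (length x) × P (rotate i x)
    some (k , p) with rotate-bounded k x
    ... | i , i≤n , e = i , s≤s i≤n , subst P (sym e) p

word≟ : DecidableEquality Word
word≟ = ≡-dec BP._≟_

canonical? : Decidable IsCanonical
canonical? x = allRotations? (Lex.≤-decidable BP._≟_ BP._<?_ x) x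

sameNecklace? : ∀ x y → Dec (SameNecklace x y)
sameNecklace? x y = anyRotation? (λ z → word≟ z y) x

aperiodic? : Decidable Aperiodic
aperiodic? x = map′ from to
  ((0 <? length x) ×-dec allUpTo? (λ k → (0 <? k) →-dec ¬? (word≟ (rotate k x) x)) (length x))
  where
  Moves : Set
  Moves = ∀ {k} → k < length x → 0 < k → rotate k x ≢ x
  from : 0 < length x × Moves → Aperiodic x
  from (ne , moves) = rotate≢⇒aperiodic ne moves
  to : Aperiodic x → 0 < length x × Moves
  to ap = aperiodic⇒nonempty ap , λ k<n 0<k → aperiodic⇒rotate≢ ap 0<k k<n

≺? : ∀ v u → Dec (v ≺ u)
≺? v u = Lex.<-decidable BP._≟_ BP._<?_ _ _ ⊎-dec (word≟ _ _ ×-dec (length v <? length u))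

symLyndonBelow? : ∀ w n → Decidable (SymLyndonBelow w n)
symLyndonBelow? w n x =
  (length x ≟ n) ×-dec ((canonical? x ×-dec aperiodic? x ×-dec sameNecklace? x (S x)) ×-dec ≺? x w)

Enumerates : (Word → Set) → List Word → Set
Enumerates P L = Unique L × (∀ x → (x ∈ L) ⇔ P x)

allWords : ℕ → List Word
allWords zero    = [ [] ]
allWords (suc n) = map (false ∷_) (allWords n) ++ map (true ∷_) (allWords n)

allWords-unique : ∀ n → Unique (allWords n)
allWords-unique zero    = All.[] ∷ []
allWords-unique (suc n) =
  UP.++⁺ (UP.map⁺ ∷-injectiveʳ (allWords-unique n)) (UP.map⁺ ∷-injectiveʳ (allWords-unique n)) disjoint
  where
  disjoint : ∀ {v} → ¬ (v ∈ map (false ∷_) (allWords n) × v ∈ map (true ∷_) (allWords n))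
  disjoint (p , q) with ∈-map⁻ (false ∷_) p | ∈-map⁻ (true ∷_) q
  ... | _ , _ , refl | _ , _ , ()

∈-allWords : ∀ x → x ∈ allWords (length x)
∈-allWords []          = here refl
∈-allWords (false ∷ x) = ∈-++⁺ˡ (∈-map⁺ (false ∷_) (∈-allWords x))
∈-allWords (true ∷ x)  = ∈-++⁺ʳ _ (∈-map⁺ (true ∷_) (∈-allWords x))

enumerate : ∀ {P : Word → Set} → Decidable P → ∀ n → (∀ {x} → P x → length x ≡ n) →
            Σ (List Word) (Enumerates P)
enumerate {P} P? n len =
  filter P? (allWords n) , UP.filter⁺ P? (allWords-unique n) , λ x → mk⇔ (sound x) (complete x)
  where
  sound : ∀ x → x ∈ filter P? (allWords n) → P x
  sound x x∈ = proj₂ (∈-filter⁻ P? {xs = allWords n} x∈)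
  complete : ∀ x → P x → x ∈ filter P? (allWords n)
  complete x px = ∈-filter⁺ P? (subst (λ m → x ∈ allWords m) (len px) (∈-allWords x)) px

rotations : ℕ → Word → List Word
rotations n x = applyUpTo (λ k → rotate k x) n

orbits : ℕ → List Word → List Word
orbits n = concatMap (rotations n)

length-orbits : ∀ n L → length (orbits n L) ≡ n * length L
length-orbits n []       = sym (*-zeroʳ n)
length-orbits n (x ∷ xs) = begin
  length (rotations n x ++ orbits n xs)         ≡⟨ length-++ (rotations n x) ⟩
  length (rotations n x) + length (orbits n xs) ≡⟨ cong₂ _+_ (length-applyUpTo _ n) (length-orbits n xs) ⟩
  n + n * length xs                             ≡⟨ *-suc n (length xs) ⟨
  n * suc (length xs)                           ∎
  where open ≡-Reasoning

∈-orbits⁻ : ∀ n L {v} → v ∈ orbits n L →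
            Σ Word λ x → x ∈ L × ∃ λ k → k < n × rotate k x ≡ v
∈-orbits⁻ n (x ∷ xs) v∈ with ∈-++⁻ (rotations n x) v∈
... | inj₁ v∈x with ∈-applyUpTo⁻ (λ k → rotate k x) v∈x
...   | k , k<n , refl = x , here refl , k , k<n , refl
∈-orbits⁻ n (x ∷ xs) v∈ | inj₂ v∈xs with ∈-orbits⁻ n xs v∈xs
...   | y , y∈ , rest = y , there y∈ , rest

∈-orbits⁺ : ∀ n {L x k} → x ∈ L → k < n → rotate k x ∈ orbits n L
∈-orbits⁺ n {y ∷ ys} (here refl) k<n = ∈-++⁺ˡ (∈-applyUpTo⁺ (λ k → rotate k y) k<n)
∈-orbits⁺ n {y ∷ ys} (there x∈) k<n = ∈-++⁺ʳ (rotations n y) (∈-orbits⁺ n x∈ k<n)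

rotations-unique : ∀ {x} → Aperiodic x → Unique (rotations (length x) x)
rotations-unique {x} ap = UP.applyUpTo⁺₁ (λ k → rotate k x) (length x) distinct
  where
  distinct : ∀ {i j} → i < j → j < length x → rotate i x ≢ rotate j x
  distinct {i} {j} i<j j<n e = aperiodic⇒rotate≢ ap (m<n⇒0<n∸m i<j) (≤-<-trans (m∸n≤m j i) j<n)
    (rotate-injective i (begin
      rotate i (rotate (j ∸ i) x) ≡⟨ rotate-+ i (j ∸ i) x ⟨
      rotate (i + (j ∸ i)) x      ≡⟨ cong (λ k → rotate k x) (m+[n∸m]≡n (<⇒≤ i<j)) ⟩
      rotate j x                  ≡⟨ e ⟨
      rotate i x                  ∎))
    where open ≡-Reasoning

InNecklaceOf : (Word → Set) → Word → Set
InNecklaceOf P v = Σ Word λ x → SameNecklace v x × P x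

LyndonRep : ℕ → Word → Set
LyndonRep n x = length x ≡ n × IsCanonical x × Aperiodic x

orbits-unique : ∀ n {L} → (∀ {x} → x ∈ L → LyndonRep n x) → Unique L → Unique (orbits n L)
orbits-unique n {[]}     _  _              = []
orbits-unique n {x ∷ xs} ns (x∉xs ∷ uniq) with ns (here refl)
... | refl , canonical , ap = UP.++⁺ (rotations-unique ap) (orbits-unique n (ns ∘ there) uniq) disjoint
  where
  disjoint : ∀ {v} → ¬ (v ∈ rotations (length x) x × v ∈ orbits (length x) xs)
  disjoint (v∈x , v∈xs) with ∈-applyUpTo⁻ (λ k → rotate k x) v∈x | ∈-orbits⁻ (length x) xs v∈xs
  ... | i , _ , refl | y , y∈ , j , _ , e with ns (there y∈)
  ...   | _ , canonical-y , _ =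
    All.lookup x∉xs y∈ (canonical-unique canonical canonical-y
                          (sameNecklace-trans (i , refl) (sameNecklace-sym (j , e))))

orbits-enumerates : ∀ {P : Word → Set} {L} n → (∀ {x} → P x → LyndonRep n x) →
                    Enumerates P L → Enumerates (InNecklaceOf P) (orbits n L)
orbits-enumerates {P} {L} n props (uniq , members) =
  orbits-unique n (props ∘ Equivalence.to (members _)) uniq , λ v → mk⇔ (sound v) (complete v)
  where
  sound : ∀ v → v ∈ orbits n L → InNecklaceOf P v
  sound v v∈ with ∈-orbits⁻ n L v∈
  ... | x , x∈ , k , _ , e = x , sameNecklace-sym (k , e) , Equivalence.to (members x) x∈
  complete : ∀ v → InNecklaceOf P v → v ∈ orbits n L
  complete v (x , necklace , px) with props px | sameNecklace-sym necklace
  ... | len , _ , ap | k , e with rotate-reduce k x (aperiodic⇒nonempty ap)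
  ...   | i , i<n , eᵢ = subst (_∈ orbits n L) (trans eᵢ e)
                               (∈-orbits⁺ n (Equivalence.from (members x) px) (subst (i <_) len i<n))

mainTheorem6 : (w : Word) (r : ℕ) → 0 < r →
    Σ ℕ λ rankSL → HasCard (SymLyndonBelow w (2 * r)) rankSL
                 × HasCard (RB w r) (2 * r * rankSL)
mainTheorem6 w r 0<r with enumerate (symLyndonBelow? w (2 * r)) (2 * r) proj₁
... | L , uniq , members =
  length L , (L , uniq , members , refl) , (orbits (2 * r) L , proj₁ orbit , rb , length-orbits (2 * r) L)
  where
  orbit : Enumerates (InNecklaceOf (SymLyndonBelow w (2 * r))) (orbits (2 * r) L)
  orbit = orbits-enumerates (2 * r) (λ (len , (canonical , ap , _) , _) → len , canonical , ap)
                            (uniq , members)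
  rb : ∀ v → (v ∈ orbits (2 * r) L) ⇔ RB w r v
  rb v = mk⇔ (λ v∈ → let x , necklace , sx = Equivalence.to (proj₂ orbit v) v∈
                     in sameNecklace-symLyndonBelow⇒RB 0<r necklace sx)
             (λ (_ , orbit-v , _) → Equivalence.from (proj₂ orbit v) orbit-v)
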